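{- For integers $n\geq 0$ and $k$, let $a_{nk}(q)=\sum_{\sigma\in \mathrm{Inv}(n,k)} q^{v(\sigma)}$. Then $a_{00}(q)=1$, $a_{0k}(q)=0$ for $k>0$, and for all $n>0$ and $k\geq 0$, \[ a_{nk}(q) = a_{n-1,k-1}(q) + [k+1]_q\, a_{n-1,k+1}(q), \] where $[k+1]_q = 1+q+\dots+q^{k}$.
   Context: $\mathrm{Inv}(n,k)$ is the set of involutions in the symmetric group $S_n$ on $[n]=\{1,\dots,n\}$ having exactly $k$ fixed points (empty if $k<0$ or no such involution exists). The extended chord diagram of an involution $\sigma$ on $[n]$ has nodes $1,\dots,n,\infty$ on a line, with an arc joining $i$ and $j$ for each $2$-cycle $(i,j)$ of $\sigma$, and an arc joining $i$ to $\infty$ for each fixed point $i$ of $\sigma$ (where $\infty$ is regarded as larger than every element of $[n]$). A crossing is a pair of arcs $(i,j),(k,l)$ with $i<k<j<l$. $v(\sigma)$ is the number of crossings of the extended chord diagram of $\sigma$. Here $q$ is an indeterminate. -}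

module Defs where

open import Data.Nat using (ℕ; zero; suc; _+_; _*_; _∸_; _<_; _<?_; _≟_)
open import Data.Integer using (ℤ; +_)
import Data.Integer as ℤ
open import Data.Fin using (Fin; toℕ)
import Data.Fin as F
open import Data.Vec using (Vec; []; _∷_; lookup)
open import Data.List using (List; []; _∷_; map; concatMap; filter; length; foldr; allFin; upTo)
open import Data.Product using (_×_; _,_; proj₁; proj₂)
open import Relation.Nullary using (Dec; yes; no; _×-dec_)
open import Relation.Binary.PropositionalEquality using (_≡_)
open import Data.List.Relation.Unary.All using (All)
import Data.List.Relation.Unary.All as All

-- Polynomials in q with natural-number coefficients, represented by
-- their coefficient sequences  (p d = coefficient of q^d).
-- Two polynomials are equal iff all coefficients agree.

Poly : Set
Poly = ℕ → ℕ

_≗ₚ_ : Poly → Poly → Set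
p ≗ₚ r = (d : ℕ) → p d ≡ r d

0ₚ : Poly
0ₚ _ = 0

qpow : ℕ → Poly
qpow e d with e ≟ d
... | yes _ = 1
... | no  _ = 0

1ₚ : Poly
1ₚ = qpow 0

_+ₚ_ : Poly → Poly → Poly
(p +ₚ r) d = p d + r d

sumBelow : ℕ → (ℕ → ℕ) → ℕ
sumBelow zero    f = 0
sumBelow (suc m) f = sumBelow m f + f m

_*ₚ_ : Poly → Poly → Poly
(p *ₚ r) d = sumBelow (suc d) (λ i → p i * r (d ∸ i))

qint : ℕ → Poly
qint m d with d <? m
... | yes _ = 1
... | no  _ = 0

sumₚ : List Poly → Poly
sumₚ = foldr _+ₚ_ 0ₚ

-- Maps [n] → [n], represented (0-indexed) as Fin n → Fin n.
-- All of them are enumerated via vectors of images.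

allVecs : (n m : ℕ) → List (Vec (Fin n) m)
allVecs n zero    = [] ∷ []
allVecs n (suc m) = concatMap (λ i → map (i ∷_) (allVecs n m)) (allFin n)

allMaps : (n : ℕ) → List (Fin n → Fin n)
allMaps n = map lookup (allVecs n n)

IsInvolution : {n : ℕ} → (Fin n → Fin n) → Set
IsInvolution {n} σ = All (λ i → σ (σ i) ≡ i) (allFin n)

isInvolution? : {n : ℕ} → (σ : Fin n → Fin n) → Dec (IsInvolution σ)
isInvolution? {n} σ = All.all? (λ i → σ (σ i) F.≟ i) (allFin n)

fixedPoints : {n : ℕ} → (Fin n → Fin n) → ℕ
fixedPoints {n} σ = length (filter (λ i → σ i F.≟ i) (allFin n))

-- Extended chord diagram: nodes 0,…,n-1 (standing for 1,…,n) and
-- ∞ represented by n (larger than every node).  An arc (i,j), i<j, for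
-- each 2-cycle, and an arc (i,∞) for each fixed point i.

arcOf : {n : ℕ} → (Fin n → Fin n) → Fin n → List (ℕ × ℕ)
arcOf {n} σ i with toℕ i <? toℕ (σ i) | σ i F.≟ i
... | yes _ | _     = (toℕ i , toℕ (σ i)) ∷ []
... | no  _ | yes _ = (toℕ i , n) ∷ []
... | no  _ | no  _ = []

arcs : {n : ℕ} → (Fin n → Fin n) → List (ℕ × ℕ)
arcs {n} σ = concatMap (arcOf σ) (allFin n)

Crossing : (ℕ × ℕ) → (ℕ × ℕ) → Set
Crossing (i , j) (k , l) = (i < k) × (k < j) × (j < l)

crossing? : (a b : ℕ × ℕ) → Dec (Crossing a b)
crossing? (i , j) (k , l) = (i <? k) ×-dec ((k <? j) ×-dec (j <? l))

allPairs : {A : Set} → List A → List (A × A)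
allPairs xs = concatMap (λ a → map (a ,_) xs) xs

v : {n : ℕ} → (Fin n → Fin n) → ℕ
v σ = length (filter (λ ab → crossing? (proj₁ ab) (proj₂ ab)) (allPairs (arcs σ)))

-- Inv(n,k) for k : ℤ (empty when k < 0)

InInv : (n : ℕ) → ℤ → (Fin n → Fin n) → Set
InInv n k σ = IsInvolution σ × (+ fixedPoints σ ≡ k)

inInv? : (n : ℕ) (k : ℤ) (σ : Fin n → Fin n) → Dec (InInv n k σ)
inInv? n k σ = isInvolution? σ ×-dec (+ fixedPoints σ ℤ.≟ k)

Inv : (n : ℕ) → ℤ → List (Fin n → Fin n)
Inv n k = filter (inInv? n k) (allMaps n)

a : ℕ → ℤ → Poly
a n k = sumₚ (map (λ σ → qpow (v σ)) (Inv n k))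

-- Classify σ ∈ Inv(n,k) by the arc at node 1.  If 1 is fixed, deleting it (and its arc to ∞,
-- which crosses nothing) leaves an element of Inv(n-1,k-1) with the same crossings.  If 1 is
-- paired with j+1, replace the 2-cycle (1, j+1) by a fixed point j: this gives τ ∈ Inv(n-1,k+1),
-- and the arc (1, j+1) crosses exactly the arcs that the new arc (j, ∞) crosses, together with
-- the arcs (i, ∞) for the r fixed points i < j of τ.  So v(σ) = v(τ) + r, and (r, τ) ranges
-- bijectively over {0,…,k} × Inv(n-1,k+1), which is the factor [k+1]_q.  Both sides of the
-- recurrence are compared coefficientwise, as numbers of involutions with a given crossing number.
module Submission where

open import Defs
open import Data.Nat using (ℕ; suc; _>_; _∸_)
open import Data.Integer using (ℤ; +_; _-_)
open import Data.Product using (_×_)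

open import Data.Nat as N using (zero; _+_; _*_; _≤_; _<_; _<?_; z≤n; s≤s)
import Data.Nat.Properties as NP
open import Algebra.Properties.CommutativeSemigroup NP.+-commutativeSemigroup using (interchange; xy∙z≈xz∙y)
import Data.Integer.Properties as ZP
open import Data.Bool using (Bool; true; false)
open import Data.Fin as F using (Fin; toℕ)
import Data.Fin.Properties as FP
open import Data.Vec as V using (Vec; lookup; tabulate)
import Data.Vec.Properties as VP
open import Data.List as L using (List; []; _∷_; _++_; concatMap; allFin; filter; length)
import Data.List.Properties as LP
import Data.List.Relation.Unary.All as All
open import Data.List.Membership.Propositional.Properties using (∈-allFin)
open import Data.Product using (_,_; proj₁; proj₂; ∃; map₂)
import Data.Product.Properties as PP
open import Data.Maybe using (Maybe; just; nothing)
import Data.Maybe as M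
open import Data.Maybe.Properties using (just-injective)
open import Data.Empty using (⊥-elim)
open import Relation.Nullary using (Dec; yes; no; ¬_; does; _×-dec_; ¬?)
open import Relation.Nullary.Decidable using (dec-true)
open import Relation.Unary using (Decidable)
open import Relation.Binary using (DecidableEquality; tri<; tri≈; tri>)
open import Relation.Binary.PropositionalEquality using (_≡_; refl; sym; trans; cong; cong₂; subst; _≢_; module ≡-Reasoning)
open import Function using (_∘_)

bit : Bool → ℕ
bit true  = 1
bit false = 0

𝟙 : ∀ {X : Set} → Dec X → ℕ
𝟙 d = bit (does d)

𝟙-yes : ∀ {X : Set} (d : Dec X) → X → 𝟙 d ≡ 1
𝟙-yes (yes _) _ = refl
𝟙-yes (no ¬x) x = ⊥-elim (¬x x)

𝟙-no : ∀ {X : Set} (d : Dec X) → ¬ X → 𝟙 d ≡ 0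
𝟙-no (yes x) ¬x = ⊥-elim (¬x x)
𝟙-no (no _)  _  = refl

𝟙-⇔ : ∀ {X Y : Set} (d : Dec X) (e : Dec Y) → (X → Y) → (Y → X) → 𝟙 d ≡ 𝟙 e
𝟙-⇔ (yes x) (yes y) f g = refl
𝟙-⇔ (yes x) (no ¬y) f g = ⊥-elim (¬y (f x))
𝟙-⇔ (no ¬x) (yes y) f g = ⊥-elim (¬x (g y))
𝟙-⇔ (no _)  (no _)  f g = refl

𝟙-× : ∀ {X Y : Set} (d : Dec X) (e : Dec Y) → 𝟙 (d ×-dec e) ≡ 𝟙 d * 𝟙 e
𝟙-× (yes _) e = sym (NP.+-identityʳ (𝟙 e))
𝟙-× (no _)  e = refl

sumMap : ∀ {A : Set} → (A → ℕ) → List A → ℕ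
sumMap F []       = 0
sumMap F (x ∷ xs) = F x + sumMap F xs

count : ∀ {A : Set} {P : A → Set} → Decidable P → List A → ℕ
count P? = sumMap (λ x → 𝟙 (P? x))

sumMap-cong : ∀ {A : Set} {F G : A → ℕ} (xs : List A) → (∀ x → F x ≡ G x) → sumMap F xs ≡ sumMap G xs
sumMap-cong []       e = refl
sumMap-cong (x ∷ xs) e = cong₂ _+_ (e x) (sumMap-cong xs e)

sumMap-+ : ∀ {A : Set} (F G : A → ℕ) (xs : List A) →
           sumMap (λ x → F x + G x) xs ≡ sumMap F xs + sumMap G xs
sumMap-+ F G []       = refl
sumMap-+ F G (x ∷ xs) rewrite sumMap-+ F G xs = interchange (F x) (G x) (sumMap F xs) (sumMap G xs)

sumMap-++ : ∀ {A : Set} (F : A → ℕ) (xs ys : List A) → sumMap F (xs ++ ys) ≡ sumMap F xs + sumMap F ys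
sumMap-++ F []       ys = refl
sumMap-++ F (x ∷ xs) ys rewrite sumMap-++ F xs ys = sym (NP.+-assoc (F x) (sumMap F xs) (sumMap F ys))

sumMap-map : ∀ {A B : Set} (F : B → ℕ) (h : A → B) (xs : List A) → sumMap F (L.map h xs) ≡ sumMap (F ∘ h) xs
sumMap-map F h []       = refl
sumMap-map F h (x ∷ xs) = cong (λ s → F (h x) + s) (sumMap-map F h xs)

sumMap-concatMap : ∀ {A B : Set} (F : B → ℕ) (h : A → List B) (xs : List A) →
                   sumMap F (concatMap h xs) ≡ sumMap (sumMap F ∘ h) xs
sumMap-concatMap F h []       = refl
sumMap-concatMap F h (x ∷ xs) =
  trans (sumMap-++ F (h x) (concatMap h xs)) (cong (λ s → sumMap F (h x) + s) (sumMap-concatMap F h xs))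

sumMap-zero : ∀ {A : Set} (F : A → ℕ) (xs : List A) → (∀ x → F x ≡ 0) → sumMap F xs ≡ 0
sumMap-zero F []       e = refl
sumMap-zero F (x ∷ xs) e rewrite e x = sumMap-zero F xs e

sumMap-*ʳ : ∀ {A : Set} (F : A → ℕ) (c : ℕ) (xs : List A) → sumMap (λ x → F x * c) xs ≡ sumMap F xs * c
sumMap-*ʳ F c []       = refl
sumMap-*ʳ F c (x ∷ xs) rewrite sumMap-*ʳ F c xs = sym (NP.*-distribʳ-+ c (F x) (sumMap F xs))

sumMap-*ˡ : ∀ {A : Set} (F : A → ℕ) (c : ℕ) (xs : List A) → sumMap (λ x → c * F x) xs ≡ c * sumMap F xs
sumMap-*ˡ F c []       = sym (NP.*-zeroʳ c)
sumMap-*ˡ F c (x ∷ xs) rewrite sumMap-*ˡ F c xs = sym (NP.*-distribˡ-+ c (F x) (sumMap F xs))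

sumMap-swap : ∀ {A B : Set} (H : A → B → ℕ) (xs : List A) (ys : List B) →
              sumMap (λ x → sumMap (H x) ys) xs ≡ sumMap (λ y → sumMap (λ x → H x y) xs) ys
sumMap-swap H []       ys = sym (sumMap-zero _ ys (λ _ → refl))
sumMap-swap H (x ∷ xs) ys rewrite sumMap-swap H xs ys = sym (sumMap-+ (H x) (λ y → sumMap (λ x → H x y) xs) ys)

sumMap-filter : ∀ {A : Set} {P : A → Set} (P? : Decidable P) (F : A → ℕ) (xs : List A) →
                sumMap F (filter P? xs) ≡ sumMap (λ x → 𝟙 (P? x) * F x) xs
sumMap-filter P? F []       = refl
sumMap-filter P? F (x ∷ xs) with P? x
... | yes _ = cong₂ _+_ (sym (NP.+-identityʳ (F x))) (sumMap-filter P? F xs)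
... | no _  = sumMap-filter P? F xs

length-filter : ∀ {A : Set} {P : A → Set} (P? : Decidable P) (xs : List A) → length (filter P? xs) ≡ count P? xs
length-filter P? []       = refl
length-filter P? (x ∷ xs) with P? x
... | yes _ = cong suc (length-filter P? xs)
... | no _  = length-filter P? xs

count-split : ∀ {A : Set} {P R : A → Set} (P? : Decidable P) (R? : Decidable R) (xs : List A) →
              count P? xs ≡ count (λ x → P? x ×-dec R? x) xs + count (λ x → P? x ×-dec ¬? (R? x)) xs
count-split P? R? [] = refl
count-split P? R? (x ∷ xs) rewrite count-split P? R? xs with P? x | R? x
... | yes _ | yes _ = refl
... | yes _ | no _  = sym (NP.+-suc _ _)
... | no _  | yes _ = refl
... | no _  | no _  = refl

occurrences : ∀ {A : Set} → DecidableEquality A → List A → A → ℕ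
occurrences _≟_ xs x = count (_≟ x) xs

module _ {A B : Set} (_≟A_ : DecidableEquality A) (_≟B_ : DecidableEquality B)
         {P : A → Set} (P? : Decidable P) {Q : B → Set} (Q? : Decidable Q)
         (xs : List A) (ys : List B) (f : A → B) (g : B → A)
         (f-pres : ∀ x → P x → Q (f x)) (g-pres : ∀ y → Q y → P (g y))
         (g∘f : ∀ x → P x → g (f x) ≡ x) (f∘g : ∀ y → Q y → f (g y) ≡ y)
         (g-once : ∀ y → Q y → occurrences _≟A_ xs (g y) ≡ 1)
         (f-once : ∀ x → P x → occurrences _≟B_ ys (f x) ≡ 1) where

  private
    incidence : A → B → ℕ
    incidence x y = 𝟙 (Q? y ×-dec (g y ≟A x))

    row-sum : ∀ x → 𝟙 (P? x) ≡ sumMap (incidence x) ys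
    row-sum x with P? x
    ... | yes px = sym (trans (sumMap-cong ys (λ y → 𝟙-⇔ (Q? y ×-dec (g y ≟A x)) (y ≟B f x)
                                  (λ { (qy , refl) → sym (f∘g y qy) })
                                  (λ { refl → f-pres x px , g∘f x px })))
                              (f-once x px))
    ... | no ¬px = sym (sumMap-zero _ ys (λ y → 𝟙-no (Q? y ×-dec (g y ≟A x)) (λ { (qy , refl) → ¬px (g-pres y qy) })))

    column-sum : ∀ y → sumMap (λ x → incidence x y) xs ≡ 𝟙 (Q? y)
    column-sum y with Q? y
    ... | yes qy = trans (sumMap-cong xs (λ x → 𝟙-⇔ (yes qy ×-dec (g y ≟A x)) (x ≟A g y)
                                          (λ p → sym (proj₂ p)) (λ e → qy , sym e)))
                         (g-once y qy)
    ... | no ¬qy = sumMap-zero _ xs (λ x → 𝟙-no (no ¬qy ×-dec (g y ≟A x)) (¬qy ∘ proj₁))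

  count-bijection : count P? xs ≡ count Q? ys
  count-bijection = begin
    count P? xs                                   ≡⟨ sumMap-cong xs row-sum ⟩
    sumMap (λ x → sumMap (incidence x) ys) xs     ≡⟨ sumMap-swap incidence xs ys ⟩
    sumMap (λ y → sumMap (λ x → incidence x y) xs) ys ≡⟨ sumMap-cong ys column-sum ⟩
    count Q? ys                                   ∎
    where open ≡-Reasoning

occurrences-product : ∀ {A B C : Set} (_≟A_ : DecidableEquality A) (_≟B_ : DecidableEquality B)
                      (_≟C_ : DecidableEquality C) (h : A → B → C) →
                      (∀ {a a′ b b′} → h a b ≡ h a′ b′ → a ≡ a′ × b ≡ b′) →
                      ∀ as bs a b → occurrences _≟C_ (concatMap (λ a′ → L.map (h a′) bs) as) (h a b)
                                    ≡ occurrences _≟A_ as a * occurrences _≟B_ bs b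
occurrences-product _≟A_ _≟B_ _≟C_ h h-injective as bs a b = begin
  count (_≟C h a b) (concatMap (λ a′ → L.map (h a′) bs) as)
    ≡⟨ sumMap-concatMap _ (λ a′ → L.map (h a′) bs) as ⟩
  sumMap (λ a′ → count (_≟C h a b) (L.map (h a′) bs)) as
    ≡⟨ sumMap-cong as (λ a′ → trans (sumMap-map _ (h a′) bs) (sumMap-cong bs (split a′))) ⟩
  sumMap (λ a′ → sumMap (λ b′ → 𝟙 (a′ ≟A a) * 𝟙 (b′ ≟B b)) bs) as
    ≡⟨ sumMap-cong as (λ a′ → sumMap-*ˡ (λ b′ → 𝟙 (b′ ≟B b)) (𝟙 (a′ ≟A a)) bs) ⟩
  sumMap (λ a′ → 𝟙 (a′ ≟A a) * occurrences _≟B_ bs b) as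
    ≡⟨ sumMap-*ʳ (λ a′ → 𝟙 (a′ ≟A a)) (occurrences _≟B_ bs b) as ⟩
  occurrences _≟A_ as a * occurrences _≟B_ bs b ∎
  where
  open ≡-Reasoning
  split : ∀ a′ b′ → 𝟙 (h a′ b′ ≟C h a b) ≡ 𝟙 (a′ ≟A a) * 𝟙 (b′ ≟B b)
  split a′ b′ = trans (𝟙-⇔ (h a′ b′ ≟C h a b) ((a′ ≟A a) ×-dec (b′ ≟B b)) h-injective (λ { (refl , refl) → refl }))
                      (𝟙-× (a′ ≟A a) (b′ ≟B b))

sumMap-allFin-suc : ∀ n (F : Fin (suc n) → ℕ) → sumMap F (allFin (suc n)) ≡ F F.zero + sumMap (F ∘ F.suc) (allFin n)
sumMap-allFin-suc n F = cong (λ s → F F.zero + s)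
  (trans (cong (sumMap F) (sym (LP.map-tabulate (λ i → i) F.suc))) (sumMap-map F F.suc (allFin n)))

occurrences-allFin : ∀ n (x : Fin n) → occurrences F._≟_ (allFin n) x ≡ 1
occurrences-allFin (suc n) F.zero = trans (sumMap-allFin-suc n (λ i → 𝟙 (i F.≟ F.zero)))
  (cong suc (sumMap-zero _ (allFin n) (λ i → 𝟙-no (F.suc i F.≟ F.zero) (λ ()))))
occurrences-allFin (suc n) (F.suc x) = trans (sumMap-allFin-suc n (λ i → 𝟙 (i F.≟ F.suc x)))
  (trans (sumMap-cong (allFin n) (λ i → 𝟙-⇔ (F.suc i F.≟ F.suc x) (i F.≟ x) FP.suc-injective (cong F.suc)))
         (occurrences-allFin n x))

_≟V_ : ∀ {n m} → DecidableEquality (Vec (Fin n) m)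
_≟V_ = VP.≡-dec F._≟_

∷-injective : ∀ {n m} {i x : Fin n} {u w : Vec (Fin n) m} →
              _≡_ {A = Vec (Fin n) (suc m)} (i V.∷ u) (x V.∷ w) → i ≡ x × u ≡ w
∷-injective refl = refl , refl

occurrences-allVecs : ∀ n m (w : Vec (Fin n) m) → occurrences _≟V_ (allVecs n m) w ≡ 1
occurrences-allVecs n zero    V.[]        = refl
occurrences-allVecs n (suc m) (x V.∷ w) = begin
  occurrences _≟V_ (allVecs n (suc m)) (x V.∷ w)
    ≡⟨ occurrences-product F._≟_ _≟V_ _≟V_ V._∷_ ∷-injective (allFin n) (allVecs n m) x w ⟩
  occurrences F._≟_ (allFin n) x * occurrences _≟V_ (allVecs n m) w
    ≡⟨ cong₂ _*_ (occurrences-allFin n x) (occurrences-allVecs n m w) ⟩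
  1 ∎
  where open ≡-Reasoning

range : ℕ → List ℕ
range zero    = []
range (suc d) = range d ++ (d ∷ [])

sumMap-range : ∀ (G : ℕ → ℕ) d → sumMap G (range d) ≡ sumBelow d G
sumMap-range G zero    = refl
sumMap-range G (suc d) = trans (sumMap-++ G (range d) (d ∷ [])) (cong₂ _+_ (sumMap-range G d) (NP.+-identityʳ (G d)))

sumMap-range-cong : ∀ (G H : ℕ → ℕ) d → (∀ i → i < d → G i ≡ H i) → sumMap G (range d) ≡ sumMap H (range d)
sumMap-range-cong G H d e = trans (sumMap-range G d) (trans (sumBelow-cong d e) (sym (sumMap-range H d)))
  where
  sumBelow-cong : ∀ d → (∀ i → i < d → G i ≡ H i) → sumBelow d G ≡ sumBelow d H
  sumBelow-cong zero    e = refl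
  sumBelow-cong (suc d) e = cong₂ _+_ (sumBelow-cong d (λ i i<d → e i (NP.m≤n⇒m≤1+n i<d))) (e d NP.≤-refl)

occurrences-range : ∀ d r → r < d → occurrences N._≟_ (range d) r ≡ 1
occurrences-range d r r<d = begin
  sumMap (λ i → 𝟙 (i N.≟ r)) (range d)        ≡⟨ sumMap-range _ d ⟩
  sumBelow d (λ i → 𝟙 (i N.≟ r))              ≡⟨ sumBelow-indicator d r<d ⟩
  1                                           ∎
  where
  open ≡-Reasoning
  sumBelow-absent : ∀ d → d ≤ r → sumBelow d (λ i → 𝟙 (i N.≟ r)) ≡ 0
  sumBelow-absent zero    _   = refl
  sumBelow-absent (suc d) d<r = cong₂ _+_ (sumBelow-absent d (NP.<⇒≤ d<r)) (𝟙-no (d N.≟ r) (λ { refl → NP.<-irrefl refl d<r }))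
  sumBelow-indicator : ∀ d → r < d → sumBelow d (λ i → 𝟙 (i N.≟ r)) ≡ 1
  sumBelow-indicator (suc d) r<1+d with r N.≟ d
  ... | yes refl = cong₂ _+_ (sumBelow-absent d NP.≤-refl) (𝟙-yes (d N.≟ d) refl)
  ... | no r≢d   = cong₂ _+_ (sumBelow-indicator d (NP.≤∧≢⇒< (NP.≤-pred r<1+d) r≢d))
                             (𝟙-no (d N.≟ r) (r≢d ∘ sym))

trues : ∀ m → (Fin m → Bool) → ℕ
trues zero    p = 0
trues (suc m) p = bit (p F.zero) + trues m (p ∘ F.suc)

truesBelow : ∀ {m} → (Fin m → Bool) → Fin m → ℕ
truesBelow p F.zero    = 0
truesBelow p (F.suc j) = bit (p F.zero) + truesBelow (p ∘ F.suc) j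

nthTrue-step : ∀ {m} → Bool → ℕ → (ℕ → Maybe (Fin m)) → Maybe (Fin (suc m))
nthTrue-step true  zero    rec = just F.zero
nthTrue-step true  (suc r) rec = M.map F.suc (rec r)
nthTrue-step false r       rec = M.map F.suc (rec r)

nthTrue : ∀ m → (Fin m → Bool) → ℕ → Maybe (Fin m)
nthTrue zero    p r = nothing
nthTrue (suc m) p r = nthTrue-step (p F.zero) r (nthTrue m (p ∘ F.suc))

trues≡sumMap : ∀ m (p : Fin m → Bool) → trues m p ≡ sumMap (bit ∘ p) (allFin m)
trues≡sumMap zero    p = refl
trues≡sumMap (suc m) p =
  trans (cong (λ s → bit (p F.zero) + s) (trues≡sumMap m (p ∘ F.suc))) (sym (sumMap-allFin-suc m (bit ∘ p)))

truesBelow≡sumMap : ∀ m (p : Fin m → Bool) j →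
                    truesBelow p j ≡ sumMap (λ i → bit (p i) * 𝟙 (toℕ i <? toℕ j)) (allFin m)
truesBelow≡sumMap (suc m) p F.zero = sym (trans (sumMap-allFin-suc m _)
  (cong₂ _+_ (NP.*-zeroʳ (bit (p F.zero)))
             (sumMap-zero _ (allFin m) (λ i → NP.*-zeroʳ (bit (p (F.suc i)))))))
truesBelow≡sumMap (suc m) p (F.suc j) =
  trans (cong (λ s → bit (p F.zero) + s) (truesBelow≡sumMap m (p ∘ F.suc) j))
        (sym (trans (sumMap-allFin-suc m _) (cong₂ _+_ (NP.*-identityʳ (bit (p F.zero)))
          (sumMap-cong (allFin m) (λ i → cong (λ s → bit (p (F.suc i)) * s)
             (𝟙-⇔ (suc (toℕ i) <? suc (toℕ j)) (toℕ i <? toℕ j) NP.≤-pred s≤s))))))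

truesBelow<trues : ∀ m (p : Fin m → Bool) j → p j ≡ true → truesBelow p j < trues m p
truesBelow<trues (suc m) p F.zero    pj rewrite pj = s≤s z≤n
truesBelow<trues (suc m) p (F.suc j) pj with p F.zero
... | true  = s≤s (truesBelow<trues m (p ∘ F.suc) j pj)
... | false = truesBelow<trues m (p ∘ F.suc) j pj

map-suc≢just-zero : ∀ {m} (x : Maybe (Fin m)) → M.map F.suc x ≢ just F.zero
map-suc≢just-zero (just _) ()
map-suc≢just-zero nothing  ()

map-suc-just-suc : ∀ {m} (x : Maybe (Fin m)) {j} → M.map F.suc x ≡ just (F.suc j) → x ≡ just j
map-suc-just-suc (just _) refl = refl
map-suc-just-suc nothing  ()

nthTrue-sound : ∀ m (p : Fin m → Bool) r j → nthTrue m p r ≡ just j → p j ≡ true × truesBelow p j ≡ r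
nthTrue-sound (suc m) p r F.zero e with p F.zero | r
... | true  | zero   = refl , refl
... | true  | suc r′ = ⊥-elim (map-suc≢just-zero (nthTrue m (p ∘ F.suc) r′) e)
... | false | r′     = ⊥-elim (map-suc≢just-zero (nthTrue m (p ∘ F.suc) r′) e)
nthTrue-sound (suc m) p r (F.suc j) e with p F.zero | r
... | true  | zero   = ⊥-elim (FP.0≢1+n (just-injective e))
... | true  | suc r′ = map₂ (cong suc) (nthTrue-sound m (p ∘ F.suc) r′ j (map-suc-just-suc (nthTrue m (p ∘ F.suc) r′) e))
... | false | r′     = nthTrue-sound m (p ∘ F.suc) r′ j (map-suc-just-suc (nthTrue m (p ∘ F.suc) r′) e)

nthTrue-truesBelow : ∀ m (p : Fin m → Bool) j → p j ≡ true → nthTrue m p (truesBelow p j) ≡ just j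
nthTrue-truesBelow (suc m) p F.zero    pj rewrite pj = refl
nthTrue-truesBelow (suc m) p (F.suc j) pj with p F.zero
... | true  rewrite nthTrue-truesBelow m (p ∘ F.suc) j pj = refl
... | false rewrite nthTrue-truesBelow m (p ∘ F.suc) j pj = refl

nthTrue-defined : ∀ m (p : Fin m → Bool) r → r < trues m p → ∃ λ j → nthTrue m p r ≡ just j
nthTrue-defined (suc m) p r r<t with p F.zero | r
... | true | zero   = F.zero , refl
... | true | suc r′ with nthTrue-defined m (p ∘ F.suc) r′ (NP.≤-pred r<t)
...   | j , e rewrite e = F.suc j , refl
nthTrue-defined (suc m) p r r<t | false | r′ with nthTrue-defined m (p ∘ F.suc) r′ r<t
...   | j , e rewrite e = F.suc j , refl

InvWithCrossings : (n : ℕ) → ℤ → ℕ → Vec (Fin n) n → Set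
InvWithCrossings n k d w = InInv n k (lookup w) × v (lookup w) ≡ d

invWithCrossings? : ∀ n k d → Decidable (InvWithCrossings n k d)
invWithCrossings? n k d w = inInv? n k (lookup w) ×-dec (v (lookup w) N.≟ d)

sumₚ-map : ∀ {A : Set} (F : A → Poly) (xs : List A) d → sumₚ (L.map F xs) d ≡ sumMap (λ x → F x d) xs
sumₚ-map F []       d = refl
sumₚ-map F (x ∷ xs) d = cong (λ s → F x d + s) (sumₚ-map F xs d)

qpow≡𝟙 : ∀ e d → qpow e d ≡ 𝟙 (e N.≟ d)
qpow≡𝟙 e d with e N.≟ d
... | yes e≡d = sym (𝟙-yes (e N.≟ d) e≡d)
... | no e≢d  = sym (𝟙-no (e N.≟ d) e≢d)

a≡count : ∀ n k d → a n k d ≡ count (invWithCrossings? n k d) (allVecs n n)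
a≡count n k d = begin
  sumₚ (L.map (λ σ → qpow (v σ)) (filter (inInv? n k) (L.map lookup (allVecs n n)))) d
    ≡⟨ sumₚ-map (λ σ → qpow (v σ)) (filter (inInv? n k) (L.map lookup (allVecs n n))) d ⟩
  sumMap (λ σ → qpow (v σ) d) (filter (inInv? n k) (L.map lookup (allVecs n n)))
    ≡⟨ sumMap-filter (inInv? n k) (λ σ → qpow (v σ) d) (L.map lookup (allVecs n n)) ⟩
  sumMap (λ σ → 𝟙 (inInv? n k σ) * qpow (v σ) d) (L.map lookup (allVecs n n))
    ≡⟨ sumMap-map _ lookup (allVecs n n) ⟩
  sumMap (λ w → 𝟙 (inInv? n k (lookup w)) * qpow (v (lookup w)) d) (allVecs n n)
    ≡⟨ sumMap-cong (allVecs n n) indicator ⟩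
  count (invWithCrossings? n k d) (allVecs n n) ∎
  where
  open ≡-Reasoning
  indicator : ∀ w → 𝟙 (inInv? n k (lookup w)) * qpow (v (lookup w)) d ≡ 𝟙 (invWithCrossings? n k d w)
  indicator w = trans (cong (𝟙 (inInv? n k (lookup w)) *_) (qpow≡𝟙 (v (lookup w)) d))
                      (sym (𝟙-× (inInv? n k (lookup w)) (v (lookup w) N.≟ d)))

Involutive : ∀ {n} → (Fin n → Fin n) → Set
Involutive σ = ∀ i → σ (σ i) ≡ i

isInvolution⇒involutive : ∀ {n} (σ : Fin n → Fin n) → IsInvolution σ → Involutive σ
isInvolution⇒involutive σ h i = All.lookup h (∈-allFin i)

involutive⇒isInvolution : ∀ {n} (σ : Fin n → Fin n) → Involutive σ → IsInvolution σ
involutive⇒isInvolution σ h = All.tabulate (λ {i} _ → h i)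

fixedPoints≡count : ∀ {n} (σ : Fin n → Fin n) → fixedPoints σ ≡ count (λ i → σ i F.≟ i) (allFin n)
fixedPoints≡count {n} σ = length-filter (λ i → σ i F.≟ i) (allFin n)

arcAt : (n : ℕ) → Fin n → Fin n → List (ℕ × ℕ)
arcAt n i x with toℕ i <? toℕ x | x F.≟ i
... | yes _ | _     = (toℕ i , toℕ x) ∷ []
... | no  _ | yes _ = (toℕ i , n) ∷ []
... | no  _ | no  _ = []

arcOf≡arcAt : ∀ {n} (σ : Fin n → Fin n) i → arcOf σ i ≡ arcAt n i (σ i)
arcOf≡arcAt {n} σ i with toℕ i <? toℕ (σ i) | σ i F.≟ i
... | yes _ | _     = refl
... | no  _ | yes _ = refl
... | no  _ | no  _ = refl

sumMap-arcs : ∀ {n} (σ : Fin n → Fin n) F → sumMap F (arcs σ) ≡ sumMap (λ i → sumMap F (arcAt n i (σ i))) (allFin n)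
sumMap-arcs {n} σ F = trans (sumMap-concatMap F (arcOf σ) (allFin n))
                            (sumMap-cong (allFin n) (λ i → cong (sumMap F) (arcOf≡arcAt σ i)))

arcAt-< : ∀ n (i x : Fin n) → toℕ i < toℕ x → arcAt n i x ≡ (toℕ i , toℕ x) ∷ []
arcAt-< n i x i<x with toℕ i <? toℕ x
... | yes _   = refl
... | no i≮x = ⊥-elim (i≮x i<x)

arcAt-fixed : ∀ n (i : Fin n) → arcAt n i i ≡ (toℕ i , n) ∷ []
arcAt-fixed n i with toℕ i <? toℕ i | i F.≟ i
... | yes i<i | _      = ⊥-elim (NP.<-irrefl refl i<i)
... | no _    | yes _  = refl
... | no _    | no i≢i = ⊥-elim (i≢i refl)

arcAt-> : ∀ n (i x : Fin n) → toℕ x < toℕ i → arcAt n i x ≡ []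
arcAt-> n i x x<i with toℕ i <? toℕ x | x F.≟ i
... | yes i<x | _       = ⊥-elim (NP.<-asym x<i i<x)
... | no _    | yes refl = ⊥-elim (NP.<-irrefl refl x<i)
... | no _    | no _    = refl

shift : ℕ × ℕ → ℕ × ℕ
shift (i , j) = (suc i , suc j)

sumMap-arcAt-suc : ∀ n (i x : Fin n) (F : ℕ × ℕ → ℕ) →
                   sumMap F (arcAt (suc n) (F.suc i) (F.suc x)) ≡ sumMap (F ∘ shift) (arcAt n i x)
sumMap-arcAt-suc n i x F with NP.<-cmp (toℕ i) (toℕ x)
... | tri< i<x _ _ rewrite arcAt-< (suc n) (F.suc i) (F.suc x) (s≤s i<x) | arcAt-< n i x i<x = refl
... | tri≈ _ i≡x _ rewrite FP.toℕ-injective i≡x | arcAt-fixed (suc n) (F.suc x) | arcAt-fixed n x = refl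
... | tri> _ _ x<i rewrite arcAt-> (suc n) (F.suc i) (F.suc x) (s≤s x<i) | arcAt-> n i x x<i = refl

crosses : ℕ × ℕ → ℕ × ℕ → ℕ
crosses α β = 𝟙 (crossing? α β)

crossings : List (ℕ × ℕ) → ℕ
crossings A = sumMap (λ α → sumMap (crosses α) A) A

v≡crossings : ∀ {n} (σ : Fin n → Fin n) → v σ ≡ crossings (arcs σ)
v≡crossings σ = trans (length-filter _ (allPairs (arcs σ)))
  (trans (sumMap-concatMap _ (λ α → L.map (α ,_) (arcs σ)) (arcs σ))
         (sumMap-cong (arcs σ) (λ α → sumMap-map _ (α ,_) (arcs σ))))

-- Equality of arc lists as multisets, expressed through sums so that no permutation is needed.
_≈ₘ_ : List (ℕ × ℕ) → List (ℕ × ℕ) → Set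
A ≈ₘ B = ∀ F → sumMap F A ≡ sumMap F B

crossings-cong : ∀ A B → A ≈ₘ B → crossings A ≡ crossings B
crossings-cong A B A≈B = trans (sumMap-cong A (λ α → A≈B (crosses α))) (A≈B (λ α → sumMap (crosses α) B))

crossings-∷ : ∀ γ A → crossings (γ ∷ A) ≡ (crosses γ γ + sumMap (crosses γ) A) + (sumMap (λ α → crosses α γ) A + crossings A)
crossings-∷ γ A = cong (λ s → (crosses γ γ + sumMap (crosses γ) A) + s)
                       (sumMap-+ (λ α → crosses α γ) (λ α → sumMap (crosses α) A) A)

crosses-shift : ∀ α β → crosses (shift α) (shift β) ≡ crosses α β
crosses-shift (i , j) (k , l) = 𝟙-⇔ (crossing? (shift (i , j)) (shift (k , l))) (crossing? (i , j) (k , l))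
  (λ { (p , q , r) → NP.≤-pred p , NP.≤-pred q , NP.≤-pred r }) (λ { (p , q , r) → s≤s p , s≤s q , s≤s r })

crossings-shift : ∀ A → crossings (L.map shift A) ≡ crossings A
crossings-shift A = trans (sumMap-map _ shift A)
  (sumMap-cong A (λ α → trans (sumMap-map (crosses (shift α)) shift A) (sumMap-cong A (crosses-shift α))))

crossings-from-0 : ∀ l A → crossings ((0 , l) ∷ L.map shift A) ≡ sumMap (crosses (0 , l) ∘ shift) A + crossings A
crossings-from-0 l A = begin
  crossings (γ ∷ L.map shift A)
    ≡⟨ crossings-∷ γ (L.map shift A) ⟩
  (crosses γ γ + sumMap (crosses γ) (L.map shift A)) + (sumMap (λ α → crosses α γ) (L.map shift A) + crossings (L.map shift A))
    ≡⟨ cong₂ _+_ (cong₂ _+_ (𝟙-no (crossing? γ γ) (λ { (() , _) })) (sumMap-map (crosses γ) shift A))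
                 (cong₂ _+_ (trans (sumMap-map (λ α → crosses α γ) shift A)
                                   (sumMap-zero _ A (λ α → 𝟙-no (crossing? (shift α) γ) (λ { (() , _) }))))
                            (crossings-shift A)) ⟩
  sumMap (crosses γ ∘ shift) A + crossings A ∎
  where
  open ≡-Reasoning
  γ : ℕ × ℕ
  γ = (0 , l)

sumMap-arcs-zero : ∀ {n} (σ : Fin n → Fin n) F → (∀ i x → sumMap F (arcAt n i x) ≡ 0) → sumMap F (arcs σ) ≡ 0
sumMap-arcs-zero {n} σ F vanish = trans (sumMap-arcs σ F) (sumMap-zero _ (allFin n) (λ i → vanish i (σ i)))

record DropsFixedZero {m} (σ : Fin (suc m) → Fin (suc m)) (τ : Fin m → Fin m) : Set where
  field
    zero-fixed : σ F.zero ≡ F.zero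
    suc-shift  : ∀ i → σ (F.suc i) ≡ F.suc (τ i)

module FixedZero {m} {σ : Fin (suc m) → Fin (suc m)} {τ : Fin m → Fin m} (S : DropsFixedZero σ τ) where
  open DropsFixedZero S

  involutive⇒ : Involutive σ → Involutive τ
  involutive⇒ σ² i = FP.suc-injective (trans (sym (suc-shift (τ i))) (trans (cong σ (sym (suc-shift i))) (σ² (F.suc i))))

  involutive⇐ : Involutive τ → Involutive σ
  involutive⇐ τ² F.zero    = trans (cong σ zero-fixed) zero-fixed
  involutive⇐ τ² (F.suc i) = trans (cong σ (suc-shift i)) (trans (suc-shift (τ i)) (cong F.suc (τ² i)))

  fixedPoints≡ : fixedPoints σ ≡ suc (fixedPoints τ)
  fixedPoints≡ = begin
    fixedPoints σ                                                   ≡⟨ fixedPoints≡count σ ⟩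
    count (λ i → σ i F.≟ i) (allFin (suc m))                        ≡⟨ sumMap-allFin-suc m (λ i → 𝟙 (σ i F.≟ i)) ⟩
    𝟙 (σ F.zero F.≟ F.zero) + count (λ i → σ (F.suc i) F.≟ F.suc i) (allFin m)
      ≡⟨ cong₂ _+_ (𝟙-yes (σ F.zero F.≟ F.zero) zero-fixed) (sumMap-cong (allFin m) shifted) ⟩
    suc (count (λ i → τ i F.≟ i) (allFin m))                        ≡⟨ cong suc (sym (fixedPoints≡count τ)) ⟩
    suc (fixedPoints τ)                                             ∎
    where
    open ≡-Reasoning
    shifted : ∀ i → 𝟙 (σ (F.suc i) F.≟ F.suc i) ≡ 𝟙 (τ i F.≟ i)
    shifted i = 𝟙-⇔ (σ (F.suc i) F.≟ F.suc i) (τ i F.≟ i)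
                    (λ e → FP.suc-injective (trans (sym (suc-shift i)) e)) (λ e → trans (suc-shift i) (cong F.suc e))

  fixedArc : ℕ × ℕ
  fixedArc = (0 , suc m)

  arcs≈ : arcs σ ≈ₘ (fixedArc ∷ L.map shift (arcs τ))
  arcs≈ F = trans (sumMap-arcs σ F) (trans (sumMap-allFin-suc m _) (cong₂ _+_
    (trans (cong (sumMap F) (trans (cong (arcAt (suc m) F.zero) zero-fixed) (arcAt-fixed (suc m) F.zero)))
           (NP.+-identityʳ (F fixedArc)))
    (trans (sumMap-cong (allFin m) (λ i → trans (cong (λ x → sumMap F (arcAt (suc m) (F.suc i) x)) (suc-shift i))
                                                (sumMap-arcAt-suc m i (τ i) F)))
           (sym (trans (sumMap-map F shift (arcs τ)) (sumMap-arcs τ (F ∘ shift)))))))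

  fixedArc-uncrossed : ∀ i (x : Fin m) → sumMap (crosses fixedArc ∘ shift) (arcAt m i x) ≡ 0
  fixedArc-uncrossed i x with NP.<-cmp (toℕ i) (toℕ x)
  ... | tri< i<x _ _ rewrite arcAt-< m i x i<x =
    cong (_+ 0) (𝟙-no (crossing? fixedArc (shift (toℕ i , toℕ x))) (λ { (_ , _ , p) → NP.<-asym p (s≤s (FP.toℕ<n x)) }))
  ... | tri≈ _ i≡x _ rewrite FP.toℕ-injective i≡x | arcAt-fixed m x =
    cong (_+ 0) (𝟙-no (crossing? fixedArc (shift (toℕ x , m))) (λ { (_ , _ , p) → NP.<-irrefl refl p }))
  ... | tri> _ _ x<i rewrite arcAt-> m i x x<i = refl

  v≡ : v σ ≡ v τ
  v≡ = begin
    v σ                                                            ≡⟨ v≡crossings σ ⟩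
    crossings (arcs σ)                                             ≡⟨ crossings-cong (arcs σ) (fixedArc ∷ L.map shift (arcs τ)) arcs≈ ⟩
    crossings (fixedArc ∷ L.map shift (arcs τ))                    ≡⟨ crossings-from-0 (suc m) (arcs τ) ⟩
    sumMap (crosses fixedArc ∘ shift) (arcs τ) + crossings (arcs τ)
      ≡⟨ cong (_+ crossings (arcs τ)) (sumMap-arcs-zero τ _ fixedArc-uncrossed) ⟩
    crossings (arcs τ)                                             ≡⟨ sym (v≡crossings τ) ⟩
    v τ                                                            ∎
    where open ≡-Reasoning

isFixed : ∀ {m} → (Fin m → Fin m) → Fin m → Bool
isFixed τ i = does (τ i F.≟ i)

trues-isFixed : ∀ {m} (τ : Fin m → Fin m) → trues m (isFixed τ) ≡ fixedPoints τ
trues-isFixed {m} τ = trans (trues≡sumMap m (isFixed τ)) (sym (fixedPoints≡count τ))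

dropIf : ∀ {A : Set} → Bool → List A → List A
dropIf true  _  = []
dropIf false xs = xs

record UnpairsZero {m} (σ : Fin (suc m) → Fin (suc m)) (τ : Fin m → Fin m) (j : Fin m) : Set where
  field
    zero-pair : σ F.zero ≡ F.suc j
    pair-zero : σ (F.suc j) ≡ F.zero
    j-fixed   : τ j ≡ j
    suc-shift : ∀ i → i ≢ j → σ (F.suc i) ≡ F.suc (τ i)

module PairedZero {m} {σ : Fin (suc m) → Fin (suc m)} {τ : Fin m → Fin m} {j : Fin m} (S : UnpairsZero σ τ j) where
  open UnpairsZero S

  involutive⇒ : Involutive σ → Involutive τ
  involutive⇒ σ² i with i F.≟ j
  ... | yes refl = trans (cong τ j-fixed) j-fixed
  ... | no i≢j   = FP.suc-injective (trans (sym (suc-shift (τ i) τi≢j)) (trans (cong σ (sym (suc-shift i i≢j))) (σ² (F.suc i))))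
    where
    τi≢j : τ i ≢ j
    τi≢j τi≡j = FP.0≢1+n (sym (trans (sym (σ² (F.suc i)))
                  (trans (cong σ (trans (suc-shift i i≢j) (trans (cong F.suc τi≡j) (sym zero-pair)))) (σ² F.zero))))

  involutive⇐ : Involutive τ → Involutive σ
  involutive⇐ τ² F.zero = trans (cong σ zero-pair) pair-zero
  involutive⇐ τ² (F.suc i) with i F.≟ j
  ... | yes refl = trans (cong σ pair-zero) zero-pair
  ... | no i≢j   = trans (cong σ (suc-shift i i≢j)) (trans (suc-shift (τ i) τi≢j) (cong F.suc (τ² i)))
    where
    τi≢j : τ i ≢ j
    τi≢j τi≡j = i≢j (trans (sym (τ² i)) (trans (cong τ τi≡j) j-fixed))

  zero-moved : σ F.zero ≢ F.zero
  zero-moved e = FP.0≢1+n (trans (sym e) zero-pair)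

  fixedPoints≡ : fixedPoints τ ≡ suc (fixedPoints σ)
  fixedPoints≡ = begin
    fixedPoints τ                                                        ≡⟨ fixedPoints≡count τ ⟩
    count (λ i → τ i F.≟ i) (allFin m)                                   ≡⟨ sumMap-cong (allFin m) fixed-split ⟩
    sumMap (λ i → 𝟙 (i F.≟ j) + 𝟙 (σ (F.suc i) F.≟ F.suc i)) (allFin m)  ≡⟨ sumMap-+ _ _ (allFin m) ⟩
    occurrences F._≟_ (allFin m) j + count (λ i → σ (F.suc i) F.≟ F.suc i) (allFin m)
      ≡⟨ cong₂ _+_ (occurrences-allFin m j) (sym fixedPoints-σ) ⟩
    suc (fixedPoints σ)                                                  ∎
    where
    open ≡-Reasoning
    fixedPoints-σ : fixedPoints σ ≡ count (λ i → σ (F.suc i) F.≟ F.suc i) (allFin m)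
    fixedPoints-σ = trans (fixedPoints≡count σ) (trans (sumMap-allFin-suc m (λ i → 𝟙 (σ i F.≟ i)))
                          (cong (_+ count (λ i → σ (F.suc i) F.≟ F.suc i) (allFin m)) (𝟙-no (σ F.zero F.≟ F.zero) zero-moved)))
    fixed-split : ∀ i → 𝟙 (τ i F.≟ i) ≡ 𝟙 (i F.≟ j) + 𝟙 (σ (F.suc i) F.≟ F.suc i)
    fixed-split i with i F.≟ j
    ... | yes refl = trans (𝟙-yes (τ i F.≟ i) j-fixed)
                           (cong suc (sym (𝟙-no (σ (F.suc i) F.≟ F.suc i) (λ e → FP.0≢1+n (trans (sym pair-zero) e)))))
    ... | no i≢j   = 𝟙-⇔ (τ i F.≟ i) (σ (F.suc i) F.≟ F.suc i)
                         (λ e → trans (suc-shift i i≢j) (cong F.suc e)) (λ e → FP.suc-injective (trans (sym (suc-shift i i≢j)) e))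

  commonArcAt : Fin m → List (ℕ × ℕ)
  commonArcAt i = dropIf (does (i F.≟ j)) (arcAt m i (τ i))

  commonArcs : List (ℕ × ℕ)
  commonArcs = concatMap commonArcAt (allFin m)

  pairArc fixedArc : ℕ × ℕ
  pairArc  = (0 , suc (toℕ j))
  fixedArc = (toℕ j , m)

  arcsσ≈ : arcs σ ≈ₘ (pairArc ∷ L.map shift commonArcs)
  arcsσ≈ F = trans (sumMap-arcs σ F) (trans (sumMap-allFin-suc m _) (cong₂ _+_
    (trans (cong (sumMap F) (trans (cong (arcAt (suc m) F.zero) zero-pair) (arcAt-< (suc m) F.zero (F.suc j) (s≤s z≤n))))
           (NP.+-identityʳ (F pairArc)))
    (trans (sumMap-cong (allFin m) arcAt-suc)
           (sym (trans (sumMap-map F shift commonArcs) (sumMap-concatMap (F ∘ shift) commonArcAt (allFin m)))))))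
    where
    arcAt-suc : ∀ i → sumMap F (arcAt (suc m) (F.suc i) (σ (F.suc i))) ≡ sumMap (F ∘ shift) (commonArcAt i)
    arcAt-suc i with i F.≟ j
    ... | yes refl = cong (sumMap F) (trans (cong (arcAt (suc m) (F.suc i)) pair-zero) (arcAt-> (suc m) (F.suc i) F.zero (s≤s z≤n)))
    ... | no i≢j   = trans (cong (λ x → sumMap F (arcAt (suc m) (F.suc i) x)) (suc-shift i i≢j)) (sumMap-arcAt-suc m i (τ i) F)

  arcsτ≈ : arcs τ ≈ₘ (fixedArc ∷ commonArcs)
  arcsτ≈ F = begin
    sumMap F (arcs τ)                                                          ≡⟨ sumMap-arcs τ F ⟩
    sumMap (λ i → sumMap F (arcAt m i (τ i))) (allFin m)                       ≡⟨ sumMap-cong (allFin m) split ⟩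
    sumMap (λ i → 𝟙 (i F.≟ j) * F fixedArc + sumMap F (commonArcAt i)) (allFin m)
      ≡⟨ sumMap-+ (λ i → 𝟙 (i F.≟ j) * F fixedArc) (sumMap F ∘ commonArcAt) (allFin m) ⟩
    sumMap (λ i → 𝟙 (i F.≟ j) * F fixedArc) (allFin m) + sumMap (sumMap F ∘ commonArcAt) (allFin m)
      ≡⟨ cong₂ _+_ (trans (sumMap-*ʳ (λ i → 𝟙 (i F.≟ j)) (F fixedArc) (allFin m))
                          (trans (cong (_* F fixedArc) (occurrences-allFin m j)) (NP.*-identityˡ (F fixedArc))))
                   (sym (sumMap-concatMap F commonArcAt (allFin m))) ⟩
    F fixedArc + sumMap F commonArcs                                           ∎
    where
    open ≡-Reasoning
    split : ∀ i → sumMap F (arcAt m i (τ i)) ≡ 𝟙 (i F.≟ j) * F fixedArc + sumMap F (commonArcAt i)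
    split i with i F.≟ j
    ... | yes refl = trans (cong (sumMap F) (trans (cong (arcAt m i) j-fixed) (arcAt-fixed m i))) (sym (NP.+-identityʳ _))
    ... | no _     = refl

  crossesFixedArc : ℕ × ℕ → ℕ
  crossesFixedArc β = crosses β fixedArc

  fixedBefore : Fin m → ℕ
  fixedBefore i = bit (isFixed τ i) * 𝟙 (toℕ i <? toℕ j)

  pairArc-crossings-at : ∀ i → sumMap (crosses pairArc ∘ shift) (commonArcAt i)
                              ≡ sumMap crossesFixedArc (commonArcAt i) + fixedBefore i
  pairArc-crossings-at i with i F.≟ j
  ... | yes refl = sym (trans (cong (bit (isFixed τ i) *_) (𝟙-no (toℕ i <? toℕ i) (NP.<-irrefl refl))) (NP.*-zeroʳ (bit (isFixed τ i))))
  ... | no i≢j with NP.<-cmp (toℕ i) (toℕ (τ i))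
  ...   | tri< i<τi i≢τi _ rewrite arcAt-< m i (τ i) i<τi | 𝟙-no (τ i F.≟ i) (λ e → i≢τi (sym (cong toℕ e))) =
    trans (cong (_+ 0) (𝟙-⇔ (crossing? pairArc (shift (toℕ i , toℕ (τ i)))) (crossing? (toℕ i , toℕ (τ i)) fixedArc)
                            (λ { (_ , q , r) → NP.≤-pred q , NP.≤-pred r , FP.toℕ<n (τ i) })
                            (λ { (p , q , _) → s≤s z≤n , s≤s p , s≤s q })))
          (sym (NP.+-identityʳ _))
  ...   | tri≈ _ i≡τi _ rewrite trans (cong (arcAt m i) (sym (FP.toℕ-injective i≡τi))) (arcAt-fixed m i)
                              | 𝟙-yes (τ i F.≟ i) (sym (FP.toℕ-injective i≡τi))
                              | 𝟙-no (crossing? (toℕ i , m) fixedArc) (λ { (_ , _ , r) → NP.<-irrefl refl r }) =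
    cong (_+ 0) (𝟙-⇔ (crossing? pairArc (shift (toℕ i , m))) (toℕ i <? toℕ j)
                     (λ { (_ , q , _) → NP.≤-pred q }) (λ p → s≤s z≤n , s≤s p , s≤s (FP.toℕ<n j)))
  ...   | tri> _ i≢τi τi<i rewrite arcAt-> m i (τ i) τi<i | 𝟙-no (τ i F.≟ i) (λ e → i≢τi (sym (cong toℕ e))) = refl

  fixedArc-crosses-none-at : ∀ i → sumMap (crosses fixedArc) (commonArcAt i) ≡ 0
  fixedArc-crosses-none-at i with i F.≟ j
  ... | yes refl = refl
  ... | no i≢j with NP.<-cmp (toℕ i) (toℕ (τ i))
  ...   | tri< i<τi _ _ rewrite arcAt-< m i (τ i) i<τi =
    cong (_+ 0) (𝟙-no (crossing? fixedArc (toℕ i , toℕ (τ i))) (λ { (_ , _ , r) → NP.<-asym r (FP.toℕ<n (τ i)) }))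
  ...   | tri≈ _ i≡τi _ rewrite trans (cong (arcAt m i) (sym (FP.toℕ-injective i≡τi))) (arcAt-fixed m i) =
    cong (_+ 0) (𝟙-no (crossing? fixedArc (toℕ i , m)) (λ { (_ , _ , r) → NP.<-irrefl refl r }))
  ...   | tri> _ _ τi<i rewrite arcAt-> m i (τ i) τi<i = refl

  fixedBelow : ℕ
  fixedBelow = truesBelow (isFixed τ) j

  pairArc-crossings : sumMap (crosses pairArc ∘ shift) commonArcs ≡ sumMap crossesFixedArc commonArcs + fixedBelow
  pairArc-crossings = begin
    sumMap (crosses pairArc ∘ shift) commonArcs
      ≡⟨ sumMap-concatMap _ commonArcAt (allFin m) ⟩
    sumMap (λ i → sumMap (crosses pairArc ∘ shift) (commonArcAt i)) (allFin m)
      ≡⟨ sumMap-cong (allFin m) pairArc-crossings-at ⟩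
    sumMap (λ i → sumMap crossesFixedArc (commonArcAt i) + fixedBefore i) (allFin m)
      ≡⟨ sumMap-+ (sumMap crossesFixedArc ∘ commonArcAt) fixedBefore (allFin m) ⟩
    sumMap (sumMap crossesFixedArc ∘ commonArcAt) (allFin m) + sumMap fixedBefore (allFin m)
      ≡⟨ cong₂ _+_ (sym (sumMap-concatMap _ commonArcAt (allFin m))) (sym (truesBelow≡sumMap m (isFixed τ) j)) ⟩
    sumMap crossesFixedArc commonArcs + fixedBelow ∎
    where open ≡-Reasoning

  v≡ : v σ ≡ v τ + fixedBelow
  v≡ = begin
    v σ                                                        ≡⟨ v≡crossings σ ⟩
    crossings (arcs σ)                                         ≡⟨ crossings-cong (arcs σ) (pairArc ∷ L.map shift commonArcs) arcsσ≈ ⟩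
    crossings (pairArc ∷ L.map shift commonArcs)               ≡⟨ crossings-from-0 (suc (toℕ j)) commonArcs ⟩
    sumMap (crosses pairArc ∘ shift) commonArcs + C            ≡⟨ cong (_+ C) pairArc-crossings ⟩
    (A + fixedBelow) + C                                       ≡⟨ xy∙z≈xz∙y A fixedBelow C ⟩
    (A + C) + fixedBelow                                       ≡⟨ cong (_+ fixedBelow) (sym crossings-τ) ⟩
    crossings (arcs τ) + fixedBelow                            ≡⟨ cong (_+ fixedBelow) (sym (v≡crossings τ)) ⟩
    v τ + fixedBelow                                           ∎
    where
    open ≡-Reasoning
    A C : ℕ
    A = sumMap crossesFixedArc commonArcs
    C = crossings commonArcs
    crossings-τ : crossings (arcs τ) ≡ A + C
    crossings-τ = trans (crossings-cong (arcs τ) (fixedArc ∷ commonArcs) arcsτ≈)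
      (trans (crossings-∷ fixedArc commonArcs)
             (cong (_+ (A + C)) (cong₂ _+_ (𝟙-no (crossing? fixedArc fixedArc) (λ { (p , _) → NP.<-irrefl refl p }))
                                           (trans (sumMap-concatMap (crosses fixedArc) commonArcAt (allFin m))
                                                  (sumMap-zero _ (allFin m) fixedArc-crosses-none-at)))))

involutive-flip : ∀ {n} (σ : Fin n → Fin n) → Involutive σ → ∀ {x y} → σ x ≡ y → σ y ≡ x
involutive-flip σ σ² {x} σx≡y = trans (cong σ (sym σx≡y)) (σ² x)

+suc≡⇒≡-1 : ∀ t k → + suc t ≡ + k → + t ≡ + k - + 1
+suc≡⇒≡-1 t (suc k) e = cong +_ (NP.suc-injective (ZP.+-injective e))

≡-1⇒+suc≡ : ∀ t k → + t ≡ + k - + 1 → + suc t ≡ + k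
≡-1⇒+suc≡ t zero    ()
≡-1⇒+suc≡ t (suc k) e = cong (λ s → + suc s) (ZP.+-injective e)

tabulate-≗-lookup : ∀ {A : Set} {n} (w : Vec A n) (h : Fin n → A) → (∀ i → h i ≡ lookup w i) → tabulate h ≡ w
tabulate-≗-lookup w h e = trans (VP.tabulate-cong e) (VP.tabulate∘lookup w)

predOr : ∀ {m} → Fin m → Fin (suc m) → Fin m
predOr i F.zero    = i
predOr i (F.suc x) = x

predOr-suc : ∀ {m} (i : Fin m) (x : Fin (suc m)) → x ≢ F.zero → x ≡ F.suc (predOr i x)
predOr-suc i F.zero    x≢0 = ⊥-elim (x≢0 refl)
predOr-suc i (F.suc x) _   = refl

dropZero : ∀ {m} → Vec (Fin (suc m)) (suc m) → Vec (Fin m) m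
dropZero w = tabulate (λ i → predOr i (lookup w (F.suc i)))

addFixedZero : ∀ {m} → (Fin m → Fin m) → Fin (suc m) → Fin (suc m)
addFixedZero τ F.zero    = F.zero
addFixedZero τ (F.suc i) = F.suc (τ i)

pairZeroWith : ∀ {m} → (Fin m → Fin m) → Fin m → Fin (suc m) → Fin (suc m)
pairZeroWith τ j F.zero = F.suc j
pairZeroWith τ j (F.suc i) with i F.≟ j
... | yes _ = F.zero
... | no _  = F.suc (τ i)

pairZeroWith-j : ∀ {m} (τ : Fin m → Fin m) j → pairZeroWith τ j (F.suc j) ≡ F.zero
pairZeroWith-j τ j with j F.≟ j
... | yes _  = refl
... | no j≢j = ⊥-elim (j≢j refl)

pairZeroWith-≢ : ∀ {m} (τ : Fin m → Fin m) j i → i ≢ j → pairZeroWith τ j (F.suc i) ≡ F.suc (τ i)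
pairZeroWith-≢ τ j i i≢j with i F.≟ j
... | yes i≡j = ⊥-elim (i≢j i≡j)
... | no _    = refl

dropZero-dropsFixedZero : ∀ {m} (w : Vec (Fin (suc m)) (suc m)) → Involutive (lookup w) → lookup w F.zero ≡ F.zero →
                          DropsFixedZero (lookup w) (lookup (dropZero w))
dropZero-dropsFixedZero w σ² σ0≡0 = record
  { zero-fixed = σ0≡0
  ; suc-shift  = λ i → trans (predOr-suc i (lookup w (F.suc i)) (λ e → FP.0≢1+n (trans (sym σ0≡0) (involutive-flip (lookup w) σ² e))))
                             (cong F.suc (sym (VP.lookup∘tabulate _ i)))
  }

addFixedZero-dropsFixedZero : ∀ {m} (u : Vec (Fin m) m) → DropsFixedZero (lookup (tabulate (addFixedZero (lookup u)))) (lookup u)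
addFixedZero-dropsFixedZero u = record
  { zero-fixed = VP.lookup∘tabulate (addFixedZero (lookup u)) F.zero
  ; suc-shift  = λ i → VP.lookup∘tabulate (addFixedZero (lookup u)) (F.suc i)
  }

dropZero-unpairsZero : ∀ {m} (w : Vec (Fin (suc m)) (suc m)) j → Involutive (lookup w) → lookup w F.zero ≡ F.suc j →
                       UnpairsZero (lookup w) (lookup (dropZero w)) j
dropZero-unpairsZero w j σ² σ0≡j+1 = record
  { zero-pair = σ0≡j+1
  ; pair-zero = σj+1≡0
  ; j-fixed   = trans (VP.lookup∘tabulate _ j) (cong (predOr j) σj+1≡0)
  ; suc-shift = λ i i≢j → trans (predOr-suc i (lookup w (F.suc i))
                                   (λ e → i≢j (FP.suc-injective (trans (sym (involutive-flip (lookup w) σ² e)) σ0≡j+1))))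
                                (cong F.suc (sym (VP.lookup∘tabulate _ i)))
  }
  where
  σj+1≡0 : lookup w (F.suc j) ≡ F.zero
  σj+1≡0 = involutive-flip (lookup w) σ² σ0≡j+1

pairZeroWith-unpairsZero : ∀ {m} (τ : Fin m → Fin m) j → τ j ≡ j → UnpairsZero (lookup (tabulate (pairZeroWith τ j))) τ j
pairZeroWith-unpairsZero τ j τj≡j = record
  { zero-pair = VP.lookup∘tabulate (pairZeroWith τ j) F.zero
  ; pair-zero = trans (VP.lookup∘tabulate (pairZeroWith τ j) (F.suc j)) (pairZeroWith-j τ j)
  ; j-fixed   = τj≡j
  ; suc-shift = λ i i≢j → trans (VP.lookup∘tabulate (pairZeroWith τ j) (F.suc i)) (pairZeroWith-≢ τ j i i≢j)
  }

zeroFixed? : ∀ {m} → Decidable (λ (w : Vec (Fin (suc m)) (suc m)) → lookup w F.zero ≡ F.zero)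
zeroFixed? w = lookup w F.zero F.≟ F.zero

count-zeroFixed : ∀ m k d → count (λ w → invWithCrossings? (suc m) (+ k) d w ×-dec zeroFixed? w) (allVecs (suc m) (suc m))
                            ≡ a m (+ k - + 1) d
count-zeroFixed m k d =
  trans (count-bijection _≟V_ _≟V_ (λ w → invWithCrossings? (suc m) (+ k) d w ×-dec zeroFixed? w) (invWithCrossings? m (+ k - + 1) d)
                         (allVecs (suc m) (suc m)) (allVecs m m)
                         dropZero addFixedZeroᵛ dropZero-pres addFixedZero-pres addFixedZero∘dropZero dropZero∘addFixedZero
                         (λ u _ → occurrences-allVecs (suc m) (suc m) (addFixedZeroᵛ u))
                         (λ w _ → occurrences-allVecs m m (dropZero w)))
        (sym (a≡count m (+ k - + 1) d))
  where
  addFixedZeroᵛ : Vec (Fin m) m → Vec (Fin (suc m)) (suc m)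
  addFixedZeroᵛ u = tabulate (addFixedZero (lookup u))

  dropZero-pres : ∀ w → InvWithCrossings (suc m) (+ k) d w × lookup w F.zero ≡ F.zero →
                  InvWithCrossings m (+ k - + 1) d (dropZero w)
  dropZero-pres w (((inv , fix) , cr) , σ0≡0) =
    (involutive⇒isInvolution (lookup (dropZero w)) (involutive⇒ σ²) , +suc≡⇒≡-1 _ k (trans (cong +_ (sym fixedPoints≡)) fix)) ,
    trans (sym v≡) cr
    where
    σ² = isInvolution⇒involutive (lookup w) inv
    open FixedZero (dropZero-dropsFixedZero w σ² σ0≡0)

  addFixedZero-pres : ∀ u → InvWithCrossings m (+ k - + 1) d u →
                      InvWithCrossings (suc m) (+ k) d (addFixedZeroᵛ u) × lookup (addFixedZeroᵛ u) F.zero ≡ F.zero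
  addFixedZero-pres u ((inv , fix) , cr) =
    ((involutive⇒isInvolution (lookup (addFixedZeroᵛ u)) (involutive⇐ (isInvolution⇒involutive (lookup u) inv)) ,
      trans (cong +_ fixedPoints≡) (≡-1⇒+suc≡ _ k fix)) , trans v≡ cr) , zero-fixed
    where
    S = addFixedZero-dropsFixedZero u
    open DropsFixedZero S
    open FixedZero S

  addFixedZero∘dropZero : ∀ w → InvWithCrossings (suc m) (+ k) d w × lookup w F.zero ≡ F.zero → addFixedZeroᵛ (dropZero w) ≡ w
  addFixedZero∘dropZero w (((inv , _) , _) , σ0≡0) = tabulate-≗-lookup w _ pointwise
    where
    open DropsFixedZero (dropZero-dropsFixedZero w (isInvolution⇒involutive (lookup w) inv) σ0≡0)
    pointwise : ∀ i → addFixedZero (lookup (dropZero w)) i ≡ lookup w i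
    pointwise F.zero    = sym σ0≡0
    pointwise (F.suc i) = sym (suc-shift i)

  dropZero∘addFixedZero : ∀ u → InvWithCrossings m (+ k - + 1) d u → dropZero (addFixedZeroᵛ u) ≡ u
  dropZero∘addFixedZero u _ = tabulate-≗-lookup u _ (λ i → cong (predOr i) (VP.lookup∘tabulate (addFixedZero (lookup u)) (F.suc i)))

≢zero⇒suc : ∀ {m} (x : Fin (suc m)) → x ≢ F.zero → ∃ λ j → x ≡ F.suc j
≢zero⇒suc F.zero    x≢0 = ⊥-elim (x≢0 refl)
≢zero⇒suc (F.suc j) _   = j , refl

does-true⁻¹ : ∀ {X : Set} (d : Dec X) → does d ≡ true → X
does-true⁻¹ (yes x) _ = x
does-true⁻¹ (no _)  ()

module CountZeroPaired (m k d : ℕ) where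

  ZeroPaired : Vec (Fin (suc m)) (suc m) → Set
  ZeroPaired w = InvWithCrossings (suc m) (+ k) d w × ¬ (lookup w F.zero ≡ F.zero)

  zeroPaired? : Decidable ZeroPaired
  zeroPaired? w = invWithCrossings? (suc m) (+ k) d w ×-dec ¬? (zeroFixed? w)

  -- (r , u) stands for the involution u together with its r-th fixed point; the bound r ≤ d rules
  -- out the junk values of the truncated subtraction d ∸ r.
  Marked : ℕ × Vec (Fin m) m → Set
  Marked (r , u) = r < suc d × r < suc k × InvWithCrossings m (+ suc k) (d ∸ r) u

  marked? : Decidable Marked
  marked? (r , u) = (r <? suc d) ×-dec ((r <? suc k) ×-dec invWithCrossings? m (+ suc k) (d ∸ r) u)

  candidates : List (ℕ × Vec (Fin m) m)
  candidates = concatMap (λ r → L.map (r ,_) (allVecs m m)) (range (suc d))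

  _≟ᶜ_ : DecidableEquality (ℕ × Vec (Fin m) m)
  _≟ᶜ_ = PP.≡-dec N._≟_ _≟V_

  partnerRank : (Fin m → Bool) → Fin (suc m) → ℕ
  partnerRank p F.zero    = 0
  partnerRank p (F.suc j) = truesBelow p j

  unpair : Vec (Fin (suc m)) (suc m) → ℕ × Vec (Fin m) m
  unpair w = partnerRank (isFixed (lookup (dropZero w))) (lookup w F.zero) , dropZero w

  pairWith : (Fin m → Fin m) → Maybe (Fin m) → Vec (Fin (suc m)) (suc m)
  pairWith τ (just j) = tabulate (pairZeroWith τ j)
  pairWith τ nothing  = tabulate (λ _ → F.zero)

  pair : ℕ × Vec (Fin m) m → Vec (Fin (suc m)) (suc m)
  pair (r , u) = pairWith (lookup u) (nthTrue m (isFixed (lookup u)) r)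

  unpair-marked : ∀ w → ZeroPaired w → Marked (unpair w)
  unpair-marked w (((inv , fix) , cr) , σ0≢0) with ≢zero⇒suc (lookup w F.zero) σ0≢0
  ... | j , σ0≡j+1 = subst Marked (sym unpair≡) (r≤d , r≤k , (isInvolution-τ , cong +_ fixedPoints-τ) , v-τ)
    where
    σ² : Involutive (lookup w)
    σ² = isInvolution⇒involutive (lookup w) inv
    τ : Fin m → Fin m
    τ = lookup (dropZero w)
    S : UnpairsZero (lookup w) τ j
    S = dropZero-unpairsZero w j σ² σ0≡j+1
    open UnpairsZero S
    open PairedZero S
    unpair≡ : unpair w ≡ (fixedBelow , dropZero w)
    unpair≡ = cong (λ x → partnerRank (isFixed τ) x , dropZero w) σ0≡j+1
    fixedPoints-τ : fixedPoints τ ≡ suc k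
    fixedPoints-τ = trans fixedPoints≡ (cong suc (ZP.+-injective fix))
    d≡ : d ≡ v τ + fixedBelow
    d≡ = trans (sym cr) v≡
    r≤d : fixedBelow < suc d
    r≤d = s≤s (subst (fixedBelow ≤_) (sym d≡) (NP.m≤n+m fixedBelow (v τ)))
    r≤k : fixedBelow < suc k
    r≤k = subst (fixedBelow <_) (trans (trues-isFixed τ) fixedPoints-τ)
                (truesBelow<trues m (isFixed τ) j (dec-true (τ j F.≟ j) j-fixed))
    isInvolution-τ : IsInvolution τ
    isInvolution-τ = involutive⇒isInvolution τ (involutive⇒ σ²)
    v-τ : v τ ≡ d ∸ fixedBelow
    v-τ = sym (trans (cong (_∸ fixedBelow) d≡) (NP.m+n∸n≡m (v τ) fixedBelow))

  record MarkedFixedPoint (r : ℕ) (u : Vec (Fin m) m) : Set where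
    field
      j       : Fin m
      nth     : nthTrue m (isFixed (lookup u)) r ≡ just j
      j-fixed : lookup u j ≡ j
      rank    : truesBelow (isFixed (lookup u)) j ≡ r

  markedFixedPoint : ∀ r u → Marked (r , u) → MarkedFixedPoint r u
  markedFixedPoint r u (_ , r≤k , (_ , fix) , _) = record
    { j = j ; nth = nth ; j-fixed = does-true⁻¹ (lookup u j F.≟ j) (proj₁ sound) ; rank = proj₂ sound }
    where
    trues≡ : trues m (isFixed (lookup u)) ≡ suc k
    trues≡ = trans (trues-isFixed (lookup u)) (ZP.+-injective fix)
    defined : ∃ λ j → nthTrue m (isFixed (lookup u)) r ≡ just j
    defined = nthTrue-defined m (isFixed (lookup u)) r (subst (r <_) (sym trues≡) r≤k)
    j : Fin m
    j = proj₁ defined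
    nth : nthTrue m (isFixed (lookup u)) r ≡ just j
    nth = proj₂ defined
    sound : isFixed (lookup u) j ≡ true × truesBelow (isFixed (lookup u)) j ≡ r
    sound = nthTrue-sound m (isFixed (lookup u)) r j nth

  pair-zeroPaired : ∀ y → Marked y → ZeroPaired (pair y)
  pair-zeroPaired (r , u) marked@(r≤d , _ , (inv , fix) , cr) = subst ZeroPaired (sym pair≡) zeroPaired
    where
    open MarkedFixedPoint (markedFixedPoint r u marked)
    τ : Fin m → Fin m
    τ = lookup u
    σ : Fin (suc m) → Fin (suc m)
    σ = lookup (tabulate (pairZeroWith τ j))
    pair≡ : pair (r , u) ≡ tabulate (pairZeroWith τ j)
    pair≡ = cong (pairWith τ) nth
    open PairedZero (pairZeroWith-unpairsZero τ j j-fixed)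
    zeroPaired : ZeroPaired (tabulate (pairZeroWith τ j))
    zeroPaired = ((involutive⇒isInvolution σ (involutive⇐ (isInvolution⇒involutive τ inv)) ,
                   cong +_ (NP.suc-injective (trans (sym fixedPoints≡) (ZP.+-injective fix)))) ,
                  trans v≡ (trans (cong₂ _+_ cr rank) (NP.m∸n+n≡m (NP.≤-pred r≤d)))) ,
                 zero-moved

  unpair∘pair : ∀ y → Marked y → unpair (pair y) ≡ y
  unpair∘pair (r , u) marked = begin
    unpair (pair (r , u))                                  ≡⟨ cong unpair (cong (pairWith τ) nth) ⟩
    unpair (tabulate (pairZeroWith τ j))
      ≡⟨ cong (λ w → partnerRank (isFixed (lookup w)) (σ F.zero) , w) dropZero∘pair ⟩
    (partnerRank (isFixed τ) (σ F.zero) , u)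
      ≡⟨ cong (λ x → partnerRank (isFixed τ) x , u) (VP.lookup∘tabulate (pairZeroWith τ j) F.zero) ⟩
    (truesBelow (isFixed τ) j , u)                         ≡⟨ cong (_, u) rank ⟩
    (r , u)                                                ∎
    where
    open ≡-Reasoning
    open MarkedFixedPoint (markedFixedPoint r u marked)
    τ : Fin m → Fin m
    τ = lookup u
    σ : Fin (suc m) → Fin (suc m)
    σ = lookup (tabulate (pairZeroWith τ j))
    pointwise : ∀ i → predOr i (σ (F.suc i)) ≡ τ i
    pointwise i with i F.≟ j
    ... | yes refl = trans (cong (predOr i) (trans (VP.lookup∘tabulate (pairZeroWith τ j) (F.suc i)) (pairZeroWith-j τ i))) (sym j-fixed)
    ... | no i≢j   = cong (predOr i) (trans (VP.lookup∘tabulate (pairZeroWith τ j) (F.suc i)) (pairZeroWith-≢ τ j i i≢j))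
    dropZero∘pair : dropZero (tabulate (pairZeroWith τ j)) ≡ u
    dropZero∘pair = tabulate-≗-lookup u _ pointwise

  pair∘unpair : ∀ w → ZeroPaired w → pair (unpair w) ≡ w
  pair∘unpair w (((inv , _) , _) , σ0≢0) with ≢zero⇒suc (lookup w F.zero) σ0≢0
  ... | j , σ0≡j+1 = begin
    pair (unpair w)                                            ≡⟨ cong (pairWith τ) (cong (nthTrue m (isFixed τ)) rank≡) ⟩
    pairWith τ (nthTrue m (isFixed τ) (truesBelow (isFixed τ) j))
      ≡⟨ cong (pairWith τ) (nthTrue-truesBelow m (isFixed τ) j (dec-true (τ j F.≟ j) j-fixed)) ⟩
    tabulate (pairZeroWith τ j)                                ≡⟨ tabulate-≗-lookup w (pairZeroWith τ j) pointwise ⟩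
    w                                                          ∎
    where
    open ≡-Reasoning
    τ : Fin m → Fin m
    τ = lookup (dropZero w)
    rank≡ : partnerRank (isFixed τ) (lookup w F.zero) ≡ truesBelow (isFixed τ) j
    rank≡ = cong (partnerRank (isFixed τ)) σ0≡j+1
    open UnpairsZero (dropZero-unpairsZero w j (isInvolution⇒involutive (lookup w) inv) σ0≡j+1)
    pointwise : ∀ i → pairZeroWith τ j i ≡ lookup w i
    pointwise F.zero = sym σ0≡j+1
    pointwise (F.suc i) with i F.≟ j
    ... | yes refl = sym pair-zero
    ... | no i≢j   = sym (suc-shift i i≢j)

  occurrences-candidates : ∀ r u → r < suc d → occurrences _≟ᶜ_ candidates (r , u) ≡ 1
  occurrences-candidates r u r≤d = begin
    occurrences _≟ᶜ_ candidates (r , u)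
      ≡⟨ occurrences-product N._≟_ _≟V_ _≟ᶜ_ _,_ (λ { refl → refl , refl }) (range (suc d)) (allVecs m m) r u ⟩
    occurrences N._≟_ (range (suc d)) r * occurrences _≟V_ (allVecs m m) u
      ≡⟨ cong₂ _*_ (occurrences-range (suc d) r r≤d) (occurrences-allVecs m m u) ⟩
    1 ∎
    where open ≡-Reasoning

  count-zeroPaired : count zeroPaired? (allVecs (suc m) (suc m)) ≡ count marked? candidates
  count-zeroPaired = count-bijection _≟V_ _≟ᶜ_ zeroPaired? marked? (allVecs (suc m) (suc m)) candidates
    unpair pair unpair-marked pair-zeroPaired pair∘unpair unpair∘pair
    (λ y _ → occurrences-allVecs (suc m) (suc m) (pair y))
    (λ w p → occurrences-candidates (proj₁ (unpair w)) (proj₂ (unpair w)) (proj₁ (unpair-marked w p)))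

  count-marked-with : ∀ r → r < suc d → count (λ u → marked? (r , u)) (allVecs m m) ≡ qint (suc k) r * a m (+ suc k) (d ∸ r)
  count-marked-with r r≤d with r <? suc k
  ... | yes r≤k = begin
    count (λ u → marked? (r , u)) (allVecs m m)
      ≡⟨ sumMap-cong (allVecs m m) (λ u → 𝟙-⇔ (marked? (r , u)) (invWithCrossings? m (+ suc k) (d ∸ r) u)
                                               (proj₂ ∘ proj₂) (λ p → r≤d , r≤k , p)) ⟩
    count (invWithCrossings? m (+ suc k) (d ∸ r)) (allVecs m m)
      ≡⟨ sym (a≡count m (+ suc k) (d ∸ r)) ⟩
    a m (+ suc k) (d ∸ r)
      ≡⟨ sym (NP.+-identityʳ _) ⟩
    1 * a m (+ suc k) (d ∸ r) ∎
    where open ≡-Reasoning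
  ... | no r≰k = sumMap-zero _ (allVecs m m) (λ u → 𝟙-no (marked? (r , u)) (r≰k ∘ proj₁ ∘ proj₂))

  count-marked : count marked? candidates ≡ (qint (suc k) *ₚ a m (+ suc k)) d
  count-marked = begin
    count marked? candidates
      ≡⟨ sumMap-concatMap _ (λ r → L.map (r ,_) (allVecs m m)) (range (suc d)) ⟩
    sumMap (λ r → count marked? (L.map (r ,_) (allVecs m m))) (range (suc d))
      ≡⟨ sumMap-range-cong _ _ (suc d) (λ r r≤d → trans (sumMap-map _ (r ,_) (allVecs m m)) (count-marked-with r r≤d)) ⟩
    sumMap (λ r → qint (suc k) r * a m (+ suc k) (d ∸ r)) (range (suc d))
      ≡⟨ sumMap-range _ (suc d) ⟩
    (qint (suc k) *ₚ a m (+ suc k)) d ∎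
    where open ≡-Reasoning

a-suc : ∀ m k → a (suc m) (+ k) ≗ₚ (a m (+ k - + 1) +ₚ (qint (suc k) *ₚ a m (+ suc k)))
a-suc m k d = begin
  a (suc m) (+ k) d
    ≡⟨ a≡count (suc m) (+ k) d ⟩
  count (invWithCrossings? (suc m) (+ k) d) (allVecs (suc m) (suc m))
    ≡⟨ count-split (invWithCrossings? (suc m) (+ k) d) zeroFixed? (allVecs (suc m) (suc m)) ⟩
  count (λ w → invWithCrossings? (suc m) (+ k) d w ×-dec zeroFixed? w) (allVecs (suc m) (suc m)) + count zeroPaired? (allVecs (suc m) (suc m))
    ≡⟨ cong₂ _+_ (count-zeroFixed m k d) (trans count-zeroPaired count-marked) ⟩
  a m (+ k - + 1) d + (qint (suc k) *ₚ a m (+ suc k)) d ∎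
  where
  open ≡-Reasoning
  open CountZeroPaired m k d

lemma2p1 : (a 0 (+ 0) ≗ₚ 1ₚ)
           × ((k : ℕ) → k > 0 → a 0 (+ k) ≗ₚ 0ₚ)
           × ((n k : ℕ) → n > 0 →
                a n (+ k) ≗ₚ (a (n ∸ 1) (+ k - + 1) +ₚ (qint (suc k) *ₚ a (n ∸ 1) (+ (suc k)))))
lemma2p1 = (λ d → NP.+-identityʳ (qpow 0 d)) , a-zero-positive , a-suc-pred
  where
  a-zero-positive : (k : ℕ) → k > 0 → a 0 (+ k) ≗ₚ 0ₚ
  a-zero-positive (suc k) _ d = refl
  a-suc-pred : (n k : ℕ) → n > 0 → a n (+ k) ≗ₚ (a (n ∸ 1) (+ k - + 1) +ₚ (qint (suc k) *ₚ a (n ∸ 1) (+ (suc k))))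
  a-suc-pred (suc m) k _ = a-suc m k
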